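{- Let $G=(A,B,E)$ be a finite bipartite graph, let $k\in\mathbb{N}$, and let $\mathcal{B}$ be a $k$-near twin partition of $B$ with representatives $B'$. Then every total order on $A$ that has crossing number at most $m$ on $G[A,B']$ has crossing number at most $m+2k$ on $G$.
   Context: For a bipartite graph $G=(A,B,E)$ and $B''\subseteq B$, $G[A,B'']$ is the induced subgraph on $A\cup B''$. $N(v)$ denotes the neighborhood of a vertex $v$ and $X\triangle Y$ the symmetric difference. For a total order on $A$ and $b\in B$, the crossing number with respect to $b$ is the number of pairs $(a,a')$ consecutive in the order with exactly one of $a,a'$ in $N(b)$; the crossing number of the order on a bipartite graph $(A,B'',\cdot)$ is the maximum over $b\in B''$. Two vertices $v,v'\in B$ are $k$-near twins if $|N(v)\triangle N(v')|\le k$. A partition $\mathcal{P}=\{P_1,\dots,P_\ell\}$ of $B$ together with a set $P'=\{v_1,\dots,v_\ell\}$ is a $k$-near twin partition with representatives $P'$ if $v_i\in P_i$ for all $i$ and every $v\in P_i$ is a $k$-near twin of $v_i$. -}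

module Defs where

open import Data.Nat using (ℕ; zero; suc; _+_; _≤_)
open import Data.Bool using (Bool; true; false; _xor_)
open import Data.Fin using (Fin; zero; suc; inject₁)
open import Function.Bundles using (_↔_; Inverse)
open import Relation.Binary.PropositionalEquality using (_≡_)
open import Data.Product using (Σ)

-- A finite bipartite graph G = (A, B, E) with A = Fin nA, B = Fin nB.
-- The edge set is given by its (decidable) indicator: a ∈ N(b) iff E a b ≡ true.
BipGraph : ℕ → ℕ → Set
BipGraph nA nB = Fin nA → Fin nB → Bool

count : ∀ {n} → (Fin n → Bool) → ℕ
count {zero}  p = 0
count {suc n} p = b2n (p zero) + count (λ i → p (suc i))
  where
  b2n : Bool → ℕ
  b2n true  = 1
  b2n false = 0

symDiffSize : ∀ {nA nB} → BipGraph nA nB → Fin nB → Fin nB → ℕ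
symDiffSize E v v' = count (λ a → E a v xor E a v')

NearTwins : ∀ {nA nB} → BipGraph nA nB → ℕ → Fin nB → Fin nB → Set
NearTwins E k v v' = symDiffSize E v v' ≤ k

-- A total order on A = Fin nA, presented by a bijection σ from positions to
-- vertices: the order is  σ 0 < σ 1 < … < σ (nA - 1).
TotalOrder : ℕ → Set
TotalOrder n = Fin n ↔ Fin n

changes : ∀ n → (Fin n → Bool) → ℕ
changes zero    f = 0
changes (suc n) f = count {n} (λ i → f (inject₁ i) xor f (suc i))

crossingWrt : ∀ {nA nB} → BipGraph nA nB → TotalOrder nA → Fin nB → ℕ
crossingWrt {nA} E σ b = changes nA (λ i → E (Inverse.to σ i) b)

-- k-near twin partition P = {P_1,…,P_ℓ} of B with representatives v_1,…,v_ℓ: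
-- `part v` is the index of the block containing v (so blocks partition B),
-- `rep i` is the representative v_i, which lies in its block P_i, and every
-- v ∈ P_i is a k-near twin of v_i.
record NearTwinPartition {nA nB} (E : BipGraph nA nB) (k : ℕ) : Set where
  field
    ℓ       : ℕ
    part    : Fin nB → Fin ℓ
    rep     : Fin ℓ → Fin nB
    rep∈    : ∀ i → part (rep i) ≡ i
    nearTwin : ∀ v → NearTwins E k v (rep (part v))

InReps : ∀ {nA nB} {E : BipGraph nA nB} {k} → NearTwinPartition E k → Fin nB → Set
InReps P b = Σ (Fin (NearTwinPartition.ℓ P)) (λ i → NearTwinPartition.rep P i ≡ b)

{-# OPTIONS --safe #-}
module Submission where

open import Defs
open import Data.Nat using (ℕ; zero; suc; _+_; _*_; _≤_; z≤n; s≤s)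
open import Data.Nat.Properties
  using (≤-reflexive; ≤-trans; +-mono-≤; +-monoʳ-≤; *-monoʳ-≤; m≤m+n; m≤n+m; +-0-commutativeMonoid; module ≤-Reasoning)
open import Data.Nat.Tactic.RingSolver using (solve-∀)
open import Data.Fin using (Fin; zero; suc; inject₁; fromℕ)
open import Data.Bool using (Bool; true; false; _xor_)
open import Data.Bool.Properties using (xor-comm)
open import Data.Product using (_,_)
open import Function.Base using (_∘_)
open import Function.Bundles using (_↔_; Inverse)
open import Relation.Binary.PropositionalEquality using (_≡_; refl; cong; cong₂; module ≡-Reasoning)
open import Algebra.Properties.CommutativeMonoid.Sum +-0-commutativeMonoid
  using (sum; sum-cong-≗; sum-init-last; sum-permute; ∑-distrib-+)

-- The number of changes of f : Fin (suc n) → Bool is the Hamming distance between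
-- f ∘ inject₁ and f ∘ suc. Two triangle inequalities through g ∘ inject₁ and g ∘ suc
-- then bound the changes of f by those of g plus twice the Hamming distance of f and g.
-- For the theorem take f, g the neighbourhoods of b and of its representative, read
-- along the order; reordering A does not change |N(b) △ N(rep)| ≤ k.

indicator : Bool → ℕ
indicator true  = 1
indicator false = 0

indicator-xor-triangle : ∀ a b c → indicator (a xor c) ≤ indicator (a xor b) + indicator (b xor c)
indicator-xor-triangle true  true  true  = z≤n
indicator-xor-triangle true  true  false = s≤s z≤n
indicator-xor-triangle true  false true  = z≤n
indicator-xor-triangle true  false false = s≤s z≤n
indicator-xor-triangle false true  true  = s≤s z≤n
indicator-xor-triangle false true  false = z≤n
indicator-xor-triangle false false true  = s≤s z≤n
indicator-xor-triangle false false false = z≤n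

sum-mono-≤ : ∀ {n} {f g : Fin n → ℕ} → (∀ i → f i ≤ g i) → sum f ≤ sum g
sum-mono-≤ {zero}  f≤g = z≤n
sum-mono-≤ {suc n} f≤g = +-mono-≤ (f≤g zero) (sum-mono-≤ (f≤g ∘ suc))

count≡sum : ∀ {n} (p : Fin n → Bool) → count p ≡ sum (indicator ∘ p)
count≡sum {zero}  p = refl
count≡sum {suc n} p with p zero | count≡sum (p ∘ suc)
... | true  | eq = cong suc eq
... | false | eq = eq

count-cong : ∀ {n} {p q : Fin n → Bool} → (∀ i → p i ≡ q i) → count p ≡ count q
count-cong {p = p} {q} p≗q = begin
  count p              ≡⟨ count≡sum p ⟩
  sum (indicator ∘ p)  ≡⟨ sum-cong-≗ (cong indicator ∘ p≗q) ⟩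
  sum (indicator ∘ q)  ≡⟨ count≡sum q ⟨
  count q              ∎
  where open ≡-Reasoning

count-permute : ∀ {n} (p : Fin n → Bool) (σ : Fin n ↔ Fin n) → count (p ∘ Inverse.to σ) ≡ count p
count-permute p σ = begin
  count (p ∘ Inverse.to σ)              ≡⟨ count≡sum (p ∘ Inverse.to σ) ⟩
  sum (indicator ∘ p ∘ Inverse.to σ)    ≡⟨ sum-permute (indicator ∘ p) σ ⟨
  sum (indicator ∘ p)                   ≡⟨ count≡sum p ⟨
  count p                               ∎
  where open ≡-Reasoning

count-inject₁≤ : ∀ {n} (p : Fin (suc n) → Bool) → count (p ∘ inject₁) ≤ count p
count-inject₁≤ p = begin
  count (p ∘ inject₁)                                      ≡⟨ count≡sum (p ∘ inject₁) ⟩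
  sum (indicator ∘ p ∘ inject₁)                            ≤⟨ m≤m+n _ _ ⟩
  sum (indicator ∘ p ∘ inject₁) + indicator (p (fromℕ _))  ≡⟨ sum-init-last (indicator ∘ p) ⟨
  sum (indicator ∘ p)                                      ≡⟨ count≡sum p ⟨
  count p                                                  ∎
  where open ≤-Reasoning

count-suc≤ : ∀ {n} (p : Fin (suc n) → Bool) → count (p ∘ suc) ≤ count p
count-suc≤ p = m≤n+m _ _

hammingDistance : ∀ {n} → (Fin n → Bool) → (Fin n → Bool) → ℕ
hammingDistance f g = count (λ i → f i xor g i)

hammingDistance-comm : ∀ {n} (f g : Fin n → Bool) → hammingDistance f g ≡ hammingDistance g f
hammingDistance-comm f g = count-cong (λ i → xor-comm (f i) (g i))

hammingDistance-triangle : ∀ {n} (f g h : Fin n → Bool) →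
  hammingDistance f h ≤ hammingDistance f g + hammingDistance g h
hammingDistance-triangle f g h = begin
  hammingDistance f h
    ≡⟨ count≡sum (λ i → f i xor h i) ⟩
  sum (λ i → indicator (f i xor h i))
    ≤⟨ sum-mono-≤ (λ i → indicator-xor-triangle (f i) (g i) (h i)) ⟩
  sum (λ i → indicator (f i xor g i) + indicator (g i xor h i))
    ≡⟨ ∑-distrib-+ (λ i → indicator (f i xor g i)) (λ i → indicator (g i xor h i)) ⟩
  sum (λ i → indicator (f i xor g i)) + sum (λ i → indicator (g i xor h i))
    ≡⟨ cong₂ _+_ (count≡sum (λ i → f i xor g i)) (count≡sum (λ i → g i xor h i)) ⟨
  hammingDistance f g + hammingDistance g h
    ∎
  where open ≤-Reasoning

hammingDistance-inject₁≤ : ∀ {n} (f g : Fin (suc n) → Bool) →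
  hammingDistance (f ∘ inject₁) (g ∘ inject₁) ≤ hammingDistance f g
hammingDistance-inject₁≤ f g = count-inject₁≤ (λ i → f i xor g i)

hammingDistance-suc≤ : ∀ {n} (f g : Fin (suc n) → Bool) →
  hammingDistance (f ∘ suc) (g ∘ suc) ≤ hammingDistance f g
hammingDistance-suc≤ f g = count-suc≤ (λ i → f i xor g i)

hammingDistance-permute : ∀ {n} (f g : Fin n → Bool) (σ : Fin n ↔ Fin n) →
  hammingDistance (f ∘ Inverse.to σ) (g ∘ Inverse.to σ) ≡ hammingDistance f g
hammingDistance-permute f g = count-permute (λ i → f i xor g i)

changes≤changes+2*hammingDistance : ∀ n (f g : Fin n → Bool) →
  changes n f ≤ changes n g + 2 * hammingDistance f g
changes≤changes+2*hammingDistance zero    f g = z≤n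
changes≤changes+2*hammingDistance (suc n) f g = begin
  changes (suc n) f
    ≡⟨⟩
  hammingDistance (f ∘ inject₁) (f ∘ suc)
    ≤⟨ hammingDistance-triangle (f ∘ inject₁) (g ∘ inject₁) (f ∘ suc) ⟩
  hammingDistance (f ∘ inject₁) (g ∘ inject₁) + hammingDistance (g ∘ inject₁) (f ∘ suc)
    ≤⟨ +-monoʳ-≤ _ (hammingDistance-triangle (g ∘ inject₁) (g ∘ suc) (f ∘ suc)) ⟩
  hammingDistance (f ∘ inject₁) (g ∘ inject₁) + (changes (suc n) g + hammingDistance (g ∘ suc) (f ∘ suc))
    ≤⟨ +-mono-≤ (hammingDistance-inject₁≤ f g) (+-monoʳ-≤ (changes (suc n) g) distance-suc≤) ⟩
  hammingDistance f g + (changes (suc n) g + hammingDistance f g)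
    ≡⟨ rearrange (hammingDistance f g) (changes (suc n) g) ⟩
  changes (suc n) g + 2 * hammingDistance f g
    ∎
  where
  open ≤-Reasoning
  distance-suc≤ : hammingDistance (g ∘ suc) (f ∘ suc) ≤ hammingDistance f g
  distance-suc≤ = ≤-trans (≤-reflexive (hammingDistance-comm (g ∘ suc) (f ∘ suc))) (hammingDistance-suc≤ f g)
  rearrange : ∀ d c → d + (c + d) ≡ c + 2 * d
  rearrange = solve-∀

lemma8 : ∀ {nA nB} (E : BipGraph nA nB) (k m : ℕ)
           (P : NearTwinPartition E k) (σ : TotalOrder nA) →
           (∀ b → InReps P b → crossingWrt E σ b ≤ m) →
           ∀ (b : Fin nB) → crossingWrt E σ b ≤ m + 2 * k
lemma8 {nA} {nB} E k m P σ reps≤m b = begin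
  crossingWrt E σ b
    ≤⟨ changes≤changes+2*hammingDistance nA (neighbourhood b ∘ Inverse.to σ) (neighbourhood r ∘ Inverse.to σ) ⟩
  crossingWrt E σ r + 2 * hammingDistance (neighbourhood b ∘ Inverse.to σ) (neighbourhood r ∘ Inverse.to σ)
    ≡⟨ cong (λ d → crossingWrt E σ r + 2 * d) (hammingDistance-permute (neighbourhood b) (neighbourhood r) σ) ⟩
  crossingWrt E σ r + 2 * symDiffSize E b r
    ≤⟨ +-mono-≤ (reps≤m r (part b , refl)) (*-monoʳ-≤ 2 (nearTwin b)) ⟩
  m + 2 * k
    ∎
  where
  open NearTwinPartition P
  open ≤-Reasoning
  neighbourhood : Fin nB → Fin nA → Bool
  neighbourhood v a = E a v
  r : Fin nB
  r = rep (part b)
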